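{- Every connected bipartite incomparable graph is undecomposable.
   Context: Two vertices are incomparable if neither of their neighborhoods is contained in the other; a graph is incomparable if its vertices are pairwise incomparable. Let $H$ be a bipartite graph with bipartition classes $X,Y$. A partition of $V(H)$ into an ordered triple $(D,N,R)$ is a bipartite decomposition if: (1) $N$ is non-empty and separates $D$ from $R$ (no edges between $D$ and $R$); (2) $|D\cap X|\ge2$ or $|D\cap Y|\ge2$; (3) $N$ induces a biclique (complete bipartite graph between $N\cap X$ and $N\cap Y$) in $H$; (4) $(D\cap X)\cup(N\cap Y)$ and $(D\cap Y)\cup(N\cap X)$ each induce bicliques in $H$. $H$ is decomposable if it admits a bipartite decomposition, and undecomposable otherwise. -}

module Defs where

open import Level using (0ℓ)
open import Data.Nat using (ℕ)
open import Data.Fin using (Fin)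
open import Data.Bool using (Bool; true; false)
open import Data.Product using (_×_; ∃; ∃-syntax; Σ)
open import Data.Sum using (_⊎_)
open import Relation.Nullary using (¬_)
open import Relation.Binary.PropositionalEquality using (_≡_; _≢_)
open import Relation.Binary.Construct.Closure.ReflexiveTransitive using (Star)

record Graph (n : ℕ) : Set₁ where
  field
    Adj     : Fin n → Fin n → Set
    sym     : ∀ {u v} → Adj u v → Adj v u
    irrefl  : ∀ {u} → ¬ Adj u u
open Graph public

Connected : ∀ {n} → Graph n → Set
Connected {n} G = ∀ (u v : Fin n) → Star (Adj G) u v

NbhdSub : ∀ {n} → Graph n → Fin n → Fin n → Set
NbhdSub G u v = ∀ w → Adj G u w → Adj G v w

IncomparableVertices : ∀ {n} → Graph n → Fin n → Fin n → Set
IncomparableVertices G u v = ¬ NbhdSub G u v × ¬ NbhdSub G v u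

IncomparableGraph : ∀ {n} → Graph n → Set
IncomparableGraph {n} G = ∀ (u v : Fin n) → u ≢ v → IncomparableVertices G u v

-- A bipartition: side u ≡ true means u ∈ X, side u ≡ false means u ∈ Y.
-- Every edge joins X and Y.
IsBipartition : ∀ {n} → Graph n → (Fin n → Bool) → Set
IsBipartition G side = ∀ {u v} → Adj G u v → side u ≢ side v

data Block : Set where
  D N R : Block

module _ {n : ℕ} (G : Graph n) (side : Fin n → Bool) where

  InX InY : Fin n → Set
  InX u = side u ≡ true
  InY u = side u ≡ false

  Biclique : (Fin n → Set) → Set
  Biclique S = ∀ x y → S x → InX x → S y → InY y → Adj G x y

  AtLeastTwo : (Fin n → Set) → Set
  AtLeastTwo P = ∃[ a ] ∃[ b ] (a ≢ b × P a × P b)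

  IsBipartiteDecomposition : (Fin n → Block) → Set
  IsBipartiteDecomposition part =
      (∃[ v ] part v ≡ N)
    × (∀ u v → part u ≡ D → part v ≡ R → ¬ Adj G u v)
      -- (2) |D ∩ X| ≥ 2 or |D ∩ Y| ≥ 2
    × (AtLeastTwo (λ u → part u ≡ D × InX u) ⊎ AtLeastTwo (λ u → part u ≡ D × InY u))
    × Biclique (λ u → part u ≡ N)
    × Biclique (λ u → (part u ≡ D × InX u) ⊎ (part u ≡ N × InY u))
    × Biclique (λ u → (part u ≡ D × InY u) ⊎ (part u ≡ N × InX u))

  Decomposable : Set
  Decomposable = ∃[ part ] IsBipartiteDecomposition part

  Undecomposable : Set
  Undecomposable = ¬ Decomposable

{-# OPTIONS --safe #-}
module Submission where

open import Defs
open import Data.Nat using (ℕ)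
open import Data.Fin using (Fin)
open import Data.Bool using (Bool; true; false)
open import Data.Bool.Properties using (¬-not)
open import Data.Product using (_×_; _,_; proj₁; ∃-syntax)
open import Data.Sum using (inj₁; inj₂)
open import Data.Empty using (⊥-elim)
open import Relation.Binary.PropositionalEquality
  using (_≡_; _≢_; refl; trans; ≢-sym) renaming (sym to ≡-sym)

-- A vertex v of N is adjacent to every vertex of D ∪ N on the other
-- side, and the neighbours of a vertex d of D all lie in D ∪ N.  Hence d is
-- dominated by v whenever they share a side, so by incomparability D lies on the
-- side opposite to N and all neighbours of D lie in N.  Then any two vertices of D
-- on a common side have the same neighbourhood, and condition (2) provides two.

≢-≢⇒≡ : {x y z : Bool} → x ≢ y → y ≢ z → x ≡ z
≢-≢⇒≡ x≢y y≢z = trans (¬-not x≢y) (≡-sym (¬-not (≢-sym y≢z)))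

module _ {n : ℕ} {G : Graph n} {side : Fin n → Bool} {part : Fin n → Block} where

  N-adjacent-opposite : IsBipartiteDecomposition G side part →
    ∀ {v w} → part v ≡ N → part w ≢ R → side v ≢ side w → Adj G v w
  N-adjacent-opposite (_ , _ , _ , biclique-N , biclique-DX∪NY , biclique-DY∪NX)
    {v} {w} pv w∉R v≁w with part w in pw | side v in sv | side w in sw
  ... | R | _     | _     = ⊥-elim (w∉R refl)
  ... | _ | true  | true  = ⊥-elim (v≁w refl)
  ... | _ | false | false = ⊥-elim (v≁w refl)
  ... | D | true  | false = biclique-DY∪NX v w (inj₂ (pv , sv)) sv (inj₁ (pw , sw)) sw
  ... | D | false | true  = sym G (biclique-DX∪NY w v (inj₁ (pw , sw)) sw (inj₂ (pv , sv)) sv)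
  ... | N | true  | false = biclique-N v w pv sv pw sw
  ... | N | false | true  = sym G (biclique-N w v pw sw pv sv)

  D-neighbour-not-R : IsBipartiteDecomposition G side part →
    ∀ {d w} → part d ≡ D → Adj G d w → part w ≢ R
  D-neighbour-not-R (_ , separated , _) pd dw pw = separated _ _ pd pw dw

  N-dominates-D-same-side : IsBipartition G side → IsBipartiteDecomposition G side part →
    ∀ {d v} → part d ≡ D → part v ≡ N → side d ≡ side v → NbhdSub G d v
  N-dominates-D-same-side bip dec pd pv d∼v w dw =
    N-adjacent-opposite dec pv (D-neighbour-not-R dec pd dw)
      (λ v∼w → bip dw (trans d∼v v∼w))

  D-opposite-N : IsBipartition G side → IsBipartiteDecomposition G side part →
    IncomparableGraph G →
    ∀ {d v} → part d ≡ D → part v ≡ N → side d ≢ side v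
  D-opposite-N bip dec inc {d} {v} pd pv d∼v =
    proj₁ (inc d v d≢v) (N-dominates-D-same-side bip dec pd pv d∼v)
    where
    d≢v : d ≢ v
    d≢v refl with () ← trans (≡-sym pd) pv

  D-twins : IsBipartition G side → IsBipartiteDecomposition G side part →
    IncomparableGraph G →
    ∀ {d d′} → part d ≡ D → part d′ ≡ D → side d ≡ side d′ → NbhdSub G d d′
  D-twins bip dec@((v , pv) , _) inc {d} {d′} pd pd′ d∼d′ w dw
    with part w in pw
  ... | R = ⊥-elim (D-neighbour-not-R dec pd dw pw)
  ... | D = ⊥-elim (D-opposite-N bip dec inc pw pv
              (≢-≢⇒≡ (≢-sym (bip dw)) (D-opposite-N bip dec inc pd pv)))
  ... | N = sym G (N-adjacent-opposite dec pw d′∉R (λ w∼d′ → bip dw (trans d∼d′ (≡-sym w∼d′))))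
    where
    d′∉R : part d′ ≢ R
    d′∉R pr with () ← trans (≡-sym pd′) pr

  D-two-on-one-side : IsBipartiteDecomposition G side part →
    ∃[ a ] ∃[ b ] (a ≢ b × part a ≡ D × part b ≡ D × side a ≡ side b)
  D-two-on-one-side (_ , _ , inj₁ (a , b , a≢b , (pa , aX) , (pb , bX)) , _) =
    a , b , a≢b , pa , pb , trans aX (≡-sym bX)
  D-two-on-one-side (_ , _ , inj₂ (a , b , a≢b , (pa , aY) , (pb , bY)) , _) =
    a , b , a≢b , pa , pb , trans aY (≡-sym bY)

proposition25 : (n : ℕ) (G : Graph n) (side : Fin n → Bool)
    → IsBipartition G side
    → Connected G
    → IncomparableGraph G
    → Undecomposable G side
proposition25 n G side bip _ inc (part , dec)
  with a , b , a≢b , pa , pb , a∼b ← D-two-on-one-side {G = G} dec =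
  proj₁ (inc a b a≢b) (D-twins {G = G} bip dec inc pa pb a∼b)
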